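{- Let $T=(D,\mathcal{L})$ be a northeast tableau with nonzero total displacement. Then there exists a northeast tableau $T'=(D',\mathcal{L}')$ that is column-equivalent to $T$ such that $D<D'$ (i.e., $D$ is obtained from $D'\neq D$ by a sequence of Kohnert moves) and $\Delta_{\mathcal{L}'}(T')=\Delta_{\mathcal{L}}(T)-1$.
   Context: A diagram is a finite subset of $\mathbb{N}\times\mathbb{N}$; $(r,c)$ is a cell in row $r$, column $c$, rows numbered bottom to top. A Kohnert move on $D$ takes the rightmost cell $(r,c)$ of some row and moves it to $(r',c)$, $r'$ the largest $1\le r'<r$ with $(r',c)\notin D$ (no move if none); $E<F$ means $E\neq F$ is obtainable from $F$ by finitely many Kohnert moves. A labeling is a map $\mathcal{L}:D\to\mathbb{N}$; strict if labels strictly increase bottom to top in each column. Two strict labelings are column-equivalent if they have the same set of labels in each column. A northeast labeling satisfies: (1) strict; (2) each label in row $i$ is at least $i$; (3) if $x'$ is in a column strictly right of $x$ and $\mathcal{L}(x')<\mathcal{L}(x)$, then some cell $x''$ in the column of $x'$ has $\mathcal{L}(x'')=\mathcal{L}(x)$; (4) if $x'$ is in a column strictly right of $x$ and $\mathcal{L}(x')=\mathcal{L}(x)$, then $x'$ is weakly below $x$. A northeast tableau is a pair $(D,\mathcal{L})$ with $\mathcal{L}$ a northeast labeling. The displacement of a cell $x=(r,c)$ is $\delta_{\mathcal{L}}(x)=\mathcal{L}(x)-r$, and the total displacement is $\Delta_{\mathcal{L}}(T)=\sum_{x\in D}\delta_{\mathcal{L}}(x)$. -}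

module Defs where

open import Data.Nat using (ℕ; _<_; _≤_; _∸_)
open import Data.Nat.ListAction using (sum)
open import Data.Product using (_×_; _,_; proj₁; proj₂; ∃; ∃-syntax)
open import Data.Sum using (_⊎_)
open import Data.List using (List; map)
open import Data.List.Membership.Propositional using (_∈_; _∉_)
open import Data.List.Relation.Unary.Unique.Propositional using (Unique)
open import Relation.Binary.PropositionalEquality using (_≡_; _≢_)
open import Relation.Binary.Construct.Closure.ReflexiveTransitive using (Star)
open import Relation.Nullary using (¬_)
open import Function.Bundles using (_⇔_)

-- A cell (r , c): row r (numbered bottom to top, starting at 1), column c.
Cell : Set
Cell = ℕ × ℕ

row : Cell → ℕ
row = proj₁

col : Cell → ℕ
col = proj₂

-- A diagram is a finite subset of ℕ×ℕ (ℕ = {1,2,...}), represented by a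
-- duplicate-free list of cells with positive coordinates.  Diagrams are
-- compared as sets (same membership).
IsDiagram : List Cell → Set
IsDiagram D = Unique D × (∀ x → x ∈ D → 1 ≤ row x × 1 ≤ col x)

_≈ᴰ_ : List Cell → List Cell → Set
D ≈ᴰ E = ∀ x → (x ∈ D) ⇔ (x ∈ E)

KohnertMove : List Cell → List Cell → Set
KohnertMove F E =
  ∃[ r ] ∃[ c ] ∃[ r' ]
    ( (r , c) ∈ F
    × (∀ c' → (r , c') ∈ F → c' ≤ c)
    × 1 ≤ r' × r' < r
    × (r' , c) ∉ F
    × (∀ r'' → r' < r'' → r'' < r → (r'' , c) ∈ F)
    × (∀ x → (x ∈ E) ⇔ ((x ∈ F × x ≢ (r , c)) ⊎ x ≡ (r' , c))) )

_<ᴷ_ : List Cell → List Cell → Set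
E <ᴷ F = ¬ (E ≈ᴰ F) × Star KohnertMove F E

-- Labelings are maps Cell → ℕ; only their values on D matter.
Labeling : Set
Labeling = Cell → ℕ

Strict : List Cell → Labeling → Set
Strict D L = ∀ x y → x ∈ D → y ∈ D → col x ≡ col y → row x < row y → L x < L y

NortheastLabeling : List Cell → Labeling → Set
NortheastLabeling D L =
    Strict D L
  × (∀ x → x ∈ D → row x ≤ L x)
  × (∀ x x' → x ∈ D → x' ∈ D → col x < col x' → L x' < L x →
       ∃[ x'' ] (x'' ∈ D × col x'' ≡ col x' × L x'' ≡ L x))
  × (∀ x x' → x ∈ D → x' ∈ D → col x < col x' → L x' ≡ L x → row x' ≤ row x)

ColumnEquivalent : List Cell → Labeling → List Cell → Labeling → Set
ColumnEquivalent D L D' L' =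
  Strict D L × Strict D' L' ×
  (∀ c n → (∃[ x ] (x ∈ D × col x ≡ c × L x ≡ n))
         ⇔ (∃[ x ] (x ∈ D' × col x ≡ c × L' x ≡ n)))

-- Displacement and total displacement (labels ≥ rows for northeast
-- labelings, so truncated subtraction is exact there).
δ : Labeling → Cell → ℕ
δ L x = L x ∸ row x

Δ : List Cell → Labeling → ℕ
Δ D L = sum (map (δ L) D)

-- Take a cell x of positive displacement, rightmost among such cells and topmost in its
-- column, and let y be the leftmost cell of x's row carrying x's label; raise y by one row,
-- keeping its label.  By the extremal choice of x no cell of the row above x has a label
-- larger than L x.  This makes the position above y empty and weakly right of every cell of
-- its row, so lowering it back is a Kohnert move, and it keeps the new labeling northeast.
-- Only the displacement of y changes, and it drops by one.
module Submission where

open import Defs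
open import Data.Nat using (ℕ; suc; _∸_; _+_; _≤_; _<_; z≤n; s≤s; _≟_; _≤?_; _<?_)
open import Data.Nat.Properties
open import Data.Nat.ListAction using (sum)
open import Data.Nat.ListAction.Properties using (sum-↭)
open import Data.Product using (_×_; _,_; proj₁; proj₂; ∃-syntax)
open import Data.Product.Properties using (≡-dec)
open import Data.Sum using (_⊎_; inj₁; inj₂)
open import Data.List using (List; []; _∷_; map; filter)
open import Data.List.Properties using (filter-accept; filter-reject; filter-all; map-cong-local)
open import Data.List.Extrema.Nat
  using (argmax; argmin; argmax-all; argmin-all; f[xs]≤f[argmax]; f[argmin]≤f[xs])
open import Data.List.Membership.Propositional using (_∈_; _∉_)
open import Data.List.Membership.Propositional.Properties using (∈-filter⁺; ∈-filter⁻)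
open import Data.List.Relation.Unary.Any using (here; there)
open import Data.List.Relation.Unary.All as All using (All)
open import Data.List.Relation.Unary.AllPairs using (_∷_)
open import Data.List.Relation.Unary.Unique.Propositional using (Unique)
open import Data.List.Relation.Unary.Unique.Propositional.Properties
  using () renaming (filter⁺ to unique-filter⁺)
open import Data.List.Relation.Binary.Permutation.Propositional
  using (_↭_; ↭-prep; ↭-swap; ↭-refl; ↭-trans; ↭-reflexive)
open import Data.List.Relation.Binary.Permutation.Propositional.Properties using (map⁺)
open import Relation.Binary.PropositionalEquality
open import Relation.Binary.Definitions using (DecidableEquality; tri<; tri≈; tri>)
open import Relation.Binary.Construct.Closure.ReflexiveTransitive using (ε; _◅_)
open import Relation.Nullary using (yes; no; ¬?; _×-dec_; contradiction)
open import Relation.Unary using (Decidable)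
open import Data.Empty using (⊥; ⊥-elim)
open import Function.Bundles using (_⇔_; mk⇔; Equivalence)

module _ {A : Set} {P : A → Set} (P? : Decidable P) (f : A → ℕ) {xs : List A} {a : A}
         (a∈xs : a ∈ xs) (pa : P a) where

  private
    ys : List A
    ys = filter P? xs

    ys-satisfying : All (λ b → b ∈ xs × P b) ys
    ys-satisfying = All.tabulate (∈-filter⁻ P?)

  maximal-satisfying : ∃[ m ] (m ∈ xs × P m × (∀ b → b ∈ xs → P b → f b ≤ f m))
  maximal-satisfying =
      argmax f a ys
    , proj₁ (argmax-all f (a∈xs , pa) ys-satisfying)
    , proj₂ (argmax-all f (a∈xs , pa) ys-satisfying)
    , λ b b∈xs pb → All.lookup (f[xs]≤f[argmax] a ys) (∈-filter⁺ P? b∈xs pb)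

  minimal-satisfying : ∃[ m ] (m ∈ xs × P m × (∀ b → b ∈ xs → P b → f m ≤ f b))
  minimal-satisfying =
      argmin f a ys
    , proj₁ (argmin-all f (a∈xs , pa) ys-satisfying)
    , proj₂ (argmin-all f (a∈xs , pa) ys-satisfying)
    , λ b b∈xs pb → All.lookup (f[argmin]≤f[xs] a ys) (∈-filter⁺ P? b∈xs pb)

sum-∸≢0⇒∃< : {A : Set} (f g : A → ℕ) (xs : List A) →
  sum (map (λ a → f a ∸ g a) xs) ≢ 0 → ∃[ a ] (a ∈ xs × g a < f a)
sum-∸≢0⇒∃< f g []       sum≢0 = contradiction refl sum≢0
sum-∸≢0⇒∃< f g (a ∷ xs) sum≢0 with g a <? f a
... | yes ga<fa = a , here refl , ga<fa
... | no  ga≮fa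
  with b , b∈xs , gb<fb ← sum-∸≢0⇒∃< f g xs (λ rest≡0 →
         sum≢0 (cong₂ _+_ (m≤n⇒m∸n≡0 (≮⇒≥ ga≮fa)) rest≡0))
  = b , there b∈xs , gb<fb

module Without {A : Set} (_≟ᴬ_ : DecidableEquality A) where

  ≢? : (y : A) → Decidable (_≢ y)
  ≢? y a = ¬? (a ≟ᴬ y)

  without : A → List A → List A
  without y = filter (≢? y)

  ∈-without⁺ : ∀ {y w xs} → w ∈ xs → w ≢ y → w ∈ without y xs
  ∈-without⁺ {y} = ∈-filter⁺ (≢? y)

  ∈-without⁻ : ∀ {y w xs} → w ∈ without y xs → w ∈ xs × w ≢ y
  ∈-without⁻ {y} = ∈-filter⁻ (≢? y)

  without-unique : ∀ {y xs} → Unique xs → Unique (without y xs)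
  without-unique {y} = unique-filter⁺ (≢? y)

  unique⇒↭-∷-without : ∀ {y xs} → Unique xs → y ∈ xs → xs ↭ y ∷ without y xs
  unique⇒↭-∷-without {xs = a ∷ xs} (a∉xs ∷ _) (here refl) =
    ↭-prep a (↭-reflexive (sym (begin
      without a (a ∷ xs) ≡⟨ filter-reject (≢? a) (λ a≢a → a≢a refl) ⟩
      without a xs       ≡⟨ filter-all (≢? a) (All.map ≢-sym a∉xs) ⟩
      xs                 ∎)))
    where open ≡-Reasoning
  unique⇒↭-∷-without {y} {a ∷ xs} (a∉xs ∷ xs-unique) (there y∈xs) =
    ↭-trans (↭-prep a (unique⇒↭-∷-without xs-unique y∈xs))
      (↭-trans (↭-swap a y ↭-refl)
        (↭-reflexive (cong (y ∷_) (sym (filter-accept (≢? y) (All.lookup a∉xs y∈xs))))))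

  sum-map-without : (f : A → ℕ) {y : A} {xs : List A} → Unique xs → y ∈ xs →
    sum (map f xs) ≡ f y + sum (map f (without y xs))
  sum-map-without f xs-unique y∈xs = sum-↭ (map⁺ f (unique⇒↭-∷-without xs-unique y∈xs))

_≟ᶜ_ : DecidableEquality Cell
_≟ᶜ_ = ≡-dec _≟_ _≟_

open Without _≟ᶜ_

strict-label<⇒row< : ∀ {D L a b} → Strict D L → a ∈ D → b ∈ D → col a ≡ col b →
  L a < L b → row a < row b
strict-label<⇒row< {L = L} {a} {b} strict a∈D b∈D ca≡cb La<Lb with <-cmp (row a) (row b)
... | tri< ra<rb _ _ = ra<rb
... | tri≈ _ ra≡rb _ = contradiction La<Lb (<-irrefl (cong L (cong₂ _,_ ra≡rb ca≡cb)))
... | tri> _ _ rb<ra = contradiction (strict b a b∈D a∈D (sym ca≡cb) rb<ra) (<-asym La<Lb)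

module RaiseCell
  (D : List Cell) (L : Labeling) (isD : IsDiagram D) (ne : NortheastLabeling D L)
  (x : Cell) (x∈D : x ∈ D) (x-displaced : row x < L x)
  (x-rightmost : ∀ w → w ∈ D → row w < L w → col w ≤ col x)
  (x-topmost : ∀ w → w ∈ D → row w < L w → col w ≡ col x → row w ≤ row x)
  (y : Cell) (y∈D : y ∈ D) (y-row : row y ≡ row x) (y-label : L y ≡ L x)
  (y-leftmost : ∀ w → w ∈ D → row w ≡ row x → L w ≡ L x → col y ≤ col w) where

  strict : Strict D L
  strict = proj₁ ne

  row≤label : ∀ w → w ∈ D → row w ≤ L w
  row≤label = proj₁ (proj₂ ne)

  smaller-label-repeats : ∀ a a' → a ∈ D → a' ∈ D → col a < col a' → L a' < L a →
    ∃[ a'' ] (a'' ∈ D × col a'' ≡ col a' × L a'' ≡ L a)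
  smaller-label-repeats = proj₁ (proj₂ (proj₂ ne))

  equal-label-not-higher : ∀ a a' → a ∈ D → a' ∈ D → col a < col a' → L a' ≡ L a →
    row a' ≤ row a
  equal-label-not-higher = proj₂ (proj₂ (proj₂ ne))

  r : ℕ
  r = row x

  y↑ : Cell
  y↑ = (suc r , col y)

  y≡[r,col-y] : y ≡ (r , col y)
  y≡[r,col-y] = cong₂ _,_ y-row refl

  row-y<row-y↑ : row y < suc r
  row-y<row-y↑ = s≤s (≤-reflexive y-row)

  -- Such a u would lie above x (strictness) and be displaced, against the choice of x.
  larger-label-in-column-of-x-⊥ : ∀ u → u ∈ D → col u ≡ col x → L x < L u →
    row u ≤ suc r → ⊥
  larger-label-in-column-of-x-⊥ u u∈D cu Lx<Lu ru≤r+1 =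
    <⇒≱ (strict-label<⇒row< strict x∈D u∈D (sym cu) Lx<Lu) (x-topmost u u∈D u-displaced cu)
    where
    u-displaced : row u < L u
    u-displaced = <-≤-trans (s≤s (≤-trans ru≤r+1 x-displaced)) Lx<Lu

  larger-label-in-row-above-x-⊥ : ∀ z → z ∈ D → row z ≡ suc r → L x < L z → ⊥
  larger-label-in-row-above-x-⊥ z z∈D rz Lx<Lz with <-cmp (col z) (col x)
  ... | tri> _ _ cx<cz = <⇒≱ cx<cz (x-rightmost z z∈D z-displaced)
    where
    z-displaced : row z < L z
    z-displaced = subst (_< L z) (sym rz) (<-≤-trans (s≤s x-displaced) Lx<Lz)
  ... | tri≈ _ cz≡cx _ = larger-label-in-column-of-x-⊥ z z∈D cz≡cx Lx<Lz (≤-reflexive rz)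
  ... | tri< cz<cx _ _ with u , u∈D , cu , Lu ← smaller-label-repeats z x z∈D x∈D cz<cx Lx<Lz =
    larger-label-in-column-of-x-⊥ u u∈D cu (subst (L x <_) (sym Lu) Lx<Lz)
      (subst (row u ≤_) rz
        (equal-label-not-higher z u z∈D u∈D (subst (col z <_) (sym cu) cz<cx) Lu))

  y↑∉D : y↑ ∉ D
  y↑∉D y↑∈D = larger-label-in-row-above-x-⊥ y↑ y↑∈D refl
    (subst (_< L y↑) y-label (strict y y↑ y∈D y↑∈D refl row-y<row-y↑))

  y↑-rightmost : ∀ z → z ∈ D → row z ≡ suc r → col z ≤ col y
  y↑-rightmost z z∈D rz with col z ≤? col y
  ... | yes cz≤cy = cz≤cy
  ... | no cz≰cy with <-cmp (L z) (L y) | ≰⇒> cz≰cy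
  ...   | tri> _ _ Ly<Lz | _ =
    ⊥-elim (larger-label-in-row-above-x-⊥ z z∈D rz (subst (_< L z) y-label Ly<Lz))
  ...   | tri≈ _ Lz≡Ly _ | cy<cz = ⊥-elim (<⇒≱ (subst (r <_) (sym rz) ≤-refl)
          (subst (row z ≤_) y-row (equal-label-not-higher y z y∈D z∈D cy<cz Lz≡Ly)))
  ...   | tri< Lz<Ly _ _ | cy<cz
    with u , u∈D , cu , Lu ← smaller-label-repeats y z y∈D z∈D cy<cz Lz<Ly =
    ⊥-elim (<⇒≱ ry<ru (equal-label-not-higher y u y∈D u∈D (subst (col y <_) (sym cu) cy<cz) Lu))
    where
    ry<ru : row y < row u
    ry<ru = <-trans (subst (row y <_) (sym rz) row-y<row-y↑)
      (strict-label<⇒row< strict z∈D u∈D (sym cu) (subst (L z <_) (sym Lu) Lz<Ly))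

  D↑ : List Cell
  D↑ = y↑ ∷ without y D

  L↑ : Labeling
  L↑ w with w ≟ᶜ y↑
  ... | yes _ = L y
  ... | no  _ = L w

  L↑-y↑ : L↑ y↑ ≡ L y
  L↑-y↑ with y↑ ≟ᶜ y↑
  ... | yes _      = refl
  ... | no  y↑≢y↑ = contradiction refl y↑≢y↑

  L↑-other : ∀ w → w ≢ y↑ → L↑ w ≡ L w
  L↑-other w w≢y↑ with w ≟ᶜ y↑
  ... | yes w≡y↑ = contradiction w≡y↑ w≢y↑
  ... | no  _    = refl

  ∈D⇒≢y↑ : ∀ w → w ∈ D → w ≢ y↑
  ∈D⇒≢y↑ w w∈D refl = y↑∉D w∈D

  ∈D↑⁻ : ∀ w → w ∈ D↑ → w ≡ y↑ ⊎ (w ∈ D × w ≢ y × w ≢ y↑)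
  ∈D↑⁻ w (here w≡y↑) = inj₁ w≡y↑
  ∈D↑⁻ w (there w∈rest) with w∈D , w≢y ← ∈-without⁻ w∈rest =
    inj₂ (w∈D , w≢y , ∈D⇒≢y↑ w w∈D)

  ∈D⇒∈D↑ : ∀ w → w ∈ D → w ≢ y → w ∈ D↑
  ∈D⇒∈D↑ w w∈D w≢y = there (∈-without⁺ w∈D w≢y)

  lower : ∀ w → w ∈ D↑ → ∃[ v ] (v ∈ D × col v ≡ col w × L v ≡ L↑ w)
  lower w w∈D↑ with ∈D↑⁻ w w∈D↑
  ... | inj₁ refl               = y , y∈D , refl , sym L↑-y↑
  ... | inj₂ (w∈D , _ , w≢y↑) = w , w∈D , refl , sym (L↑-other w w≢y↑)

  raise : ∀ u → u ∈ D → ∃[ w ] (w ∈ D↑ × col w ≡ col u × L↑ w ≡ L u)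
  raise u u∈D with u ≟ᶜ y
  ... | yes refl = y↑ , here refl , refl , L↑-y↑
  ... | no  u≢y  = u , ∈D⇒∈D↑ u u∈D u≢y , refl , L↑-other u (∈D⇒≢y↑ u u∈D)

  strict↑ : Strict D↑ L↑
  strict↑ a b a∈ b∈ cab rab with ∈D↑⁻ a a∈ | ∈D↑⁻ b b∈
  ... | inj₁ refl | inj₁ refl = contradiction rab (<-irrefl refl)
  ... | inj₁ refl | inj₂ (b∈D , _ , b≢y↑) rewrite L↑-y↑ | L↑-other b b≢y↑ =
    strict y b y∈D b∈D cab (<-trans row-y<row-y↑ rab)
  ... | inj₂ (a∈D , a≢y , a≢y↑) | inj₁ refl rewrite L↑-y↑ | L↑-other a a≢y↑ =
    strict a y a∈D y∈D cab (subst (row a <_) (sym y-row) ra<r)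
    where
    ra<r : row a < r
    ra<r = ≤∧≢⇒< (≤-pred rab) (λ ra≡r → a≢y (trans (cong₂ _,_ ra≡r cab) (sym y≡[r,col-y])))
  ... | inj₂ (a∈D , _ , a≢y↑) | inj₂ (b∈D , _ , b≢y↑)
    rewrite L↑-other a a≢y↑ | L↑-other b b≢y↑ =
    strict a b a∈D b∈D cab rab

  row≤label↑ : ∀ w → w ∈ D↑ → row w ≤ L↑ w
  row≤label↑ w w∈D↑ with ∈D↑⁻ w w∈D↑
  ... | inj₁ refl rewrite L↑-y↑ | y-label = x-displaced
  ... | inj₂ (w∈D , _ , w≢y↑) rewrite L↑-other w w≢y↑ = row≤label w w∈D

  smaller-label-repeats↑ : ∀ a a' → a ∈ D↑ → a' ∈ D↑ → col a < col a' → L↑ a' < L↑ a →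
    ∃[ a'' ] (a'' ∈ D↑ × col a'' ≡ col a' × L↑ a'' ≡ L↑ a)
  smaller-label-repeats↑ a a' a∈ a'∈ ca<ca' La'<La
    with v , v∈D , cv , Lv ← lower a a∈ | v' , v'∈D , cv' , Lv' ← lower a' a'∈
    with u , u∈D , cu , Lu ← smaller-label-repeats v v' v∈D v'∈D
           (subst₂ _<_ (sym cv) (sym cv') ca<ca') (subst₂ _<_ (sym Lv') (sym Lv) La'<La)
    with w , w∈D↑ , cw , Lw ← raise u u∈D
    = w , w∈D↑ , trans cw (trans cu cv') , trans Lw (trans Lu Lv)

  equal-label-not-higher↑ : ∀ a a' → a ∈ D↑ → a' ∈ D↑ → col a < col a' → L↑ a' ≡ L↑ a →
    row a' ≤ row a
  equal-label-not-higher↑ a a' a∈ a'∈ ca<ca' La'≡La with ∈D↑⁻ a a∈ | ∈D↑⁻ a' a'∈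
  ... | inj₁ refl | inj₁ refl = contradiction ca<ca' (<-irrefl refl)
  ... | inj₁ refl | inj₂ (a'∈D , _ , a'≢y↑) rewrite L↑-y↑ | L↑-other a' a'≢y↑ =
    ≤-trans (equal-label-not-higher y a' y∈D a'∈D ca<ca' La'≡La)
            (≤-trans (≤-reflexive y-row) (n≤1+n r))
  ... | inj₂ (a∈D , _ , a≢y↑) | inj₁ refl rewrite L↑-y↑ | L↑-other a a≢y↑ =
    subst (_≤ row a) (cong suc y-row)
      (≤∧≢⇒< (equal-label-not-higher a y a∈D y∈D ca<ca' La'≡La)
             (λ ry≡ra → <⇒≱ ca<ca'
               (y-leftmost a a∈D (trans (sym ry≡ra) y-row) (trans (sym La'≡La) y-label))))
  ... | inj₂ (a∈D , _ , a≢y↑) | inj₂ (a'∈D , _ , a'≢y↑)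
    rewrite L↑-other a a≢y↑ | L↑-other a' a'≢y↑ =
    equal-label-not-higher a a' a∈D a'∈D ca<ca' La'≡La

  northeast↑ : NortheastLabeling D↑ L↑
  northeast↑ = strict↑ , row≤label↑ , smaller-label-repeats↑ , equal-label-not-higher↑

  diagram↑ : IsDiagram D↑
  diagram↑ =
      All.tabulate (λ w∈rest → ≢-sym (∈D⇒≢y↑ _ (proj₁ (∈-without⁻ w∈rest))))
      ∷ without-unique (proj₁ isD)
    , positive
    where
    positive : ∀ w → w ∈ D↑ → 1 ≤ row w × 1 ≤ col w
    positive w w∈D↑ with ∈D↑⁻ w w∈D↑
    ... | inj₁ refl          = s≤s z≤n , proj₂ (proj₂ isD y y∈D)
    ... | inj₂ (w∈D , _ , _) = proj₂ isD w w∈D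

  column-equivalent : ColumnEquivalent D L D↑ L↑
  column-equivalent = strict , strict↑ , λ c n → mk⇔
    (λ (u , u∈D , cu , Lu) → let (w , w∈D↑ , cw , Lw) = raise u u∈D
                              in w , w∈D↑ , trans cw cu , trans Lw Lu)
    (λ (w , w∈D↑ , cw , Lw) → let (v , v∈D , cv , Lv) = lower w w∈D↑
                               in v , v∈D , trans cv cw , trans Lv Lw)

  lower-y↑ : KohnertMove D↑ D
  lower-y↑ = suc r , col y , r , here refl , y↑-rightmost↑ , proj₁ (proj₂ isD x x∈D) , ≤-refl
           , y-vacated , (λ r'' r<r'' r''<r+1 → ⊥-elim (<⇒≱ r<r'' (≤-pred r''<r+1))) , moved
    where
    y↑-rightmost↑ : ∀ c' → (suc r , c') ∈ D↑ → c' ≤ col y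
    y↑-rightmost↑ c' m with ∈D↑⁻ _ m
    ... | inj₁ eq            = ≤-reflexive (cong col eq)
    ... | inj₂ (c'∈D , _ , _) = y↑-rightmost _ c'∈D refl
    y-vacated : (r , col y) ∉ D↑
    y-vacated m with ∈D↑⁻ _ m
    ... | inj₁ eq           = <-irrefl (cong row eq) ≤-refl
    ... | inj₂ (_ , r≢y , _) = r≢y (sym y≡[r,col-y])
    moved : ∀ w → (w ∈ D) ⇔ ((w ∈ D↑ × w ≢ (suc r , col y)) ⊎ w ≡ (r , col y))
    moved w = mk⇔ to from
      where
      to : w ∈ D → (w ∈ D↑ × w ≢ (suc r , col y)) ⊎ w ≡ (r , col y)
      to w∈D with w ≟ᶜ y
      ... | yes w≡y = inj₂ (trans w≡y y≡[r,col-y])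
      ... | no  w≢y = inj₁ (∈D⇒∈D↑ w w∈D w≢y , ∈D⇒≢y↑ w w∈D)
      from : (w ∈ D↑ × w ≢ (suc r , col y)) ⊎ w ≡ (r , col y) → w ∈ D
      from (inj₁ (w∈D↑ , w≢y↑)) with ∈D↑⁻ w w∈D↑
      ... | inj₁ w≡y↑          = contradiction w≡y↑ w≢y↑
      ... | inj₂ (w∈D , _ , _) = w∈D
      from (inj₂ w≡y) = subst (_∈ D) (sym (trans w≡y (sym y≡[r,col-y]))) y∈D

  D<D↑ : D <ᴷ D↑
  D<D↑ = (λ D≈D↑ → y↑∉D (Equivalence.from (D≈D↑ y↑) (here refl))) , (lower-y↑ ◅ ε)

  Δ↑ : Δ D↑ L↑ ≡ Δ D L ∸ 1
  Δ↑ = begin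
      δ L↑ y↑ + sum (map (δ L↑) rest)
        ≡⟨ cong₂ _+_ (cong (_∸ suc r) L↑-y↑)
                     (cong sum (map-cong-local (All.tabulate same-displacement))) ⟩
      (L y ∸ suc r) + S
        ≡⟨ cong (_+ S) (cong (λ k → L y ∸ suc k) (sym y-row)) ⟩
      (L y ∸ (1 + row y)) + S
        ≡⟨ cong (λ k → (L y ∸ k) + S) (+-comm 1 (row y)) ⟩
      (L y ∸ (row y + 1)) + S
        ≡⟨ cong (_+ S) (∸-+-assoc (L y) (row y) 1) ⟨
      (δ L y ∸ 1) + S
        ≡⟨ +-∸-comm S (m<n⇒0<n∸m y-displaced) ⟨
      (δ L y + S) ∸ 1
        ≡⟨ cong (_∸ 1) (sum-map-without (δ L) (proj₁ isD) y∈D) ⟨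
      Δ D L ∸ 1 ∎
    where
    open ≡-Reasoning
    rest : List Cell
    rest = without y D
    S : ℕ
    S = sum (map (δ L) rest)
    y-displaced : row y < L y
    y-displaced = subst₂ _<_ (sym y-row) (sym y-label) x-displaced
    same-displacement : ∀ {w} → w ∈ rest → δ L↑ w ≡ δ L w
    same-displacement {w} w∈rest =
      cong (_∸ row w) (L↑-other w (∈D⇒≢y↑ w (proj₁ (∈-without⁻ w∈rest))))

lemma2p15 : (D : List Cell) (L : Labeling) →
    IsDiagram D → NortheastLabeling D L → Δ D L ≢ 0 →
    ∃[ D' ] ∃[ L' ] ( IsDiagram D' × NortheastLabeling D' L'
    × ColumnEquivalent D L D' L'
    × D <ᴷ D'
    × Δ D' L' ≡ Δ D L ∸ 1 )
lemma2p15 D L isD ne Δ≢0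
  with w , w∈D , w-displaced ← sum-∸≢0⇒∃< L row D Δ≢0
  with x₀ , x₀∈D , x₀-displaced , x₀-rightmost ←
         maximal-satisfying (λ v → row v <? L v) col w∈D w-displaced
  with x , x∈D , (x-displaced , cx≡cx₀) , x-topmost ←
         maximal-satisfying (λ v → (row v <? L v) ×-dec (col v ≟ col x₀)) row
           x₀∈D (x₀-displaced , refl)
  with y , y∈D , (y-row , y-label) , y-leftmost ←
         minimal-satisfying (λ v → (row v ≟ row x) ×-dec (L v ≟ L x)) col x∈D (refl , refl)
  = R.D↑ , R.L↑ , R.diagram↑ , R.northeast↑ , R.column-equivalent , R.D<D↑ , R.Δ↑
  where
  module R = RaiseCell D L isD ne x x∈D x-displaced
    (λ v v∈D v-displaced → subst (col v ≤_) (sym cx≡cx₀) (x₀-rightmost v v∈D v-displaced))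
    (λ v v∈D v-displaced cv≡cx → x-topmost v v∈D (v-displaced , trans cv≡cx cx≡cx₀))
    y y∈D y-row y-label (λ v v∈D rv Lv → y-leftmost v v∈D (rv , Lv))
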